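{- Consider the colorability saturation game with $k=4$ colors on a vertex set $V$ of $n$ vertices. Suppose that at some time $t_i$ Mini has just played the $t_i$-th edge, and that pairwise disjoint sets $V_1,\dots,V_i\subseteq V$ have been designated, each inducing a complete graph in $G(t_i)$. Let $W(i):=V\setminus\bigcup_{j\le i}V_j$ and $\phi(i):=|E_{t_i}[W(i)]|+|E_{t_i}[W(i),V\setminus W(i)]|$. Assume $|W(i)| \ge 6$ and there exist at least two edges $e,e' \in E_{t_i}[W(i)]$ that are isolated in $G(t_i)$. Then Maxi has a strategy for her subsequent moves such that, against every play of Mini, there exist a time $t_{i+1}$ with $t_i\le t_{i+1} \le t_i+8$ at which Mini plays the $t_{i+1}$-th edge (in particular, the game has not ended before), and a set $V_{i+1}\subseteq W(i)$ with $|V_{i+1}|=4$ inducing a complete graph in $G(t_{i+1})$, such that, with $W(i+1):=W(i)\setminus V_{i+1}$, we have $\phi(i+1):=|E_{t_{i+1}}[W(i+1)]|+|E_{t_{i+1}}[W(i+1),V\setminus W(i+1)]| \le \phi(i)+2$.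
   Context: The colorability saturation game with parameters $k,n$: two players, Maxi and Mini, start with the empty graph on vertex set $V$ with $|V|=n$ and take turns, each turn adding one edge not yet present, subject to the constraint that the current graph stays $k$-colorable; the game ends when the graph is saturated, i.e., no further edge can be added while keeping it $k$-colorable. $G(t)=(V,E_t)$ is the graph after $t$ edges have been played in total. $E_t[A]$ is the set of edges of $G(t)$ with both endpoints in $A$, and $E_t[A,B]$ the set of edges of $G(t)$ with one endpoint in $A$ and the other in $B$. An edge is isolated in a graph if both its endpoints have degree $1$. -}

module Defs where

open import Data.Nat using (ℕ; zero; suc; _+_; _≤_)
open import Data.Bool using (Bool; true; false; _∧_; _∨_)
open import Data.Fin using (Fin; _<_)
open import Data.Fin.Subset using (Subset; _∈_; _∩_; Empty; ∁)
open import Data.Vec using (lookup)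
open import Data.List using (List; []; _∷_; length; filterᵇ)
open import Data.List.Membership.Propositional using () renaming (_∈_ to _∈ₗ_)
open import Data.Product using (Σ; ∃; _×_; _,_; proj₁; proj₂)
open import Data.Sum using (_⊎_)
open import Relation.Nullary using (¬_)
open import Relation.Binary.PropositionalEquality using (_≡_; _≢_)

-- An (unordered) edge {u,v} on vertex set Fin n is stored as the pair (u , v)
-- with u < v (normalised representation).
Edge : ℕ → Set
Edge n = Fin n × Fin n

-- A game history / graph: list of the edges played so far, most recent first.
-- G(t) is a history of length t.
Graph : ℕ → Set
Graph n = List (Edge n)

Adj : ∀ {n} → Graph n → Fin n → Fin n → Set
Adj G x y = ((x , y) ∈ₗ G) ⊎ ((y , x) ∈ₗ G)

Colorable : ∀ {n} → ℕ → Graph n → Set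
Colorable {n} k G = Σ (Fin n → Fin k) λ c → ∀ {u v} → (u , v) ∈ₗ G → c u ≢ c v

data Distinct {n} : Graph n → Set where
  []  : Distinct []
  _∷_ : ∀ {e G} → ¬ (e ∈ₗ G) → Distinct G → Distinct (e ∷ G)

Normalised : ∀ {n} → Graph n → Set
Normalised G = ∀ {u v} → (u , v) ∈ₗ G → u < v

ValidPosition : ∀ {n} → ℕ → Graph n → Set
ValidPosition k G = Distinct G × Normalised G × Colorable k G

Legal : ∀ {n} → ℕ → Graph n → Edge n → Set
Legal k G (u , v) = (u < v) × ¬ ((u , v) ∈ₗ G) × Colorable k ((u , v) ∷ G)

Saturated : ∀ {n} → ℕ → Graph n → Set
Saturated {n} k G = ¬ (∃ λ (e : Edge n) → Legal k G e)

edgesIn : ∀ {n} → Subset n → Graph n → ℕ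
edgesIn A G = length (filterᵇ (λ e → lookup A (proj₁ e) ∧ lookup A (proj₂ e)) G)

edgesBetween : ∀ {n} → Subset n → Subset n → Graph n → ℕ
edgesBetween A B G =
  length (filterᵇ (λ e → (lookup A (proj₁ e) ∧ lookup B (proj₂ e))
                       ∨ (lookup B (proj₁ e) ∧ lookup A (proj₂ e))) G)

phi : ∀ {n} → Subset n → Graph n → ℕ
phi W G = edgesIn W G + edgesBetween W (∁ W) G

deg : ∀ {n} → Graph n → Fin n → ℕ
deg G x = length (filterᵇ (λ e → isX (proj₁ e) ∨ isX (proj₂ e)) G)
  where
  open import Data.Fin using (_≟_)
  open import Relation.Nullary.Decidable using (⌊_⌋)
  isX : _ → Bool
  isX y = ⌊ y ≟ x ⌋

Isolated : ∀ {n} → Graph n → Edge n → Set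
Isolated G (u , v) = ((u , v) ∈ₗ G) × deg G u ≡ 1 × deg G v ≡ 1

Clique : ∀ {n} → Graph n → Subset n → Set
Clique G A = ∀ {x y} → x ∈ A → y ∈ A → x ≢ y → Adj G x y

Disjoint : ∀ {n} → Subset n → Subset n → Set
Disjoint A B = Empty (A ∩ B)

-- MaxiForces k P d G : in position G with Maxi to move, Maxi has a strategy
-- for the next d rounds (each round: a Maxi move then a Mini move) such that,
-- against every play of Mini, at some moment right after a Mini move (or now,
-- i.e. after 0 rounds) the current graph satisfies P; in particular the game
-- has not ended before that Mini move (Maxi must have a legal move and, after
-- it, Mini must have a legal move).
data MaxiForces {n} (k : ℕ) (P : Graph n → Set) : ℕ → Graph n → Set where
  done : ∀ {d G} → P G → MaxiForces k P d G
  move : ∀ {d G} (e : Edge n) → Legal k G e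
       → ¬ Saturated k (e ∷ G)
       → (∀ f → Legal k (e ∷ G) f → MaxiForces k P d (f ∷ e ∷ G))
       → MaxiForces k P (suc d) G

BothIn : ∀ {n} → Subset n → Edge n → Set
BothIn A (u , v) = (u ∈ A) × (v ∈ A)

-- Let ab and cd be the two isolated edges in W and call a, b, c, d the corners.  In each
-- of at most four rounds Maxi adds a missing edge between {a, b} and {c, d}; afterwards
-- the corners span a K₄.  Only Mini's edges can join a corner to a non-corner, so there
-- are at most three such crossing edges while Maxi still has to move.  Re-colouring the
-- corners by a cyclic shift of the four colours then makes them rainbow without clashing
-- with their outside neighbours, so Maxi's edge is legal; and Mini can still answer, as
-- otherwise two non-corners would each need three crossing edges.  Maxi's edges avoid
-- W(i+1), Mini adds at most four edges to φ, and ab, cd no longer count: φ grows by ≤ 2.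
module Submission where

open import Defs
open import Data.Bool using (Bool; true; false; not; _∧_; _∨_; _xor_; T; T?)
import Data.Bool as Bool
open import Data.Bool.Properties using (∧-conicalˡ; ∧-conicalʳ; ∧-zeroʳ; ∨-zeroʳ)
open import Data.Empty using (⊥; ⊥-elim)
open import Data.Fin using (Fin; zero; suc; _≟_; punchIn; toℕ) renaming (_<_ to _<ᶠ_)
open import Data.Fin.Patterns using (0F; 1F; 2F; 3F)
import Data.Fin.Properties as Fin
open import Data.Fin.Properties using (suc-injective; pigeonhole; <-irrefl; <-cmp; <⇒≢; punchInᵢ≢i; punchIn-injective)
open import Data.Fin.Subset using (Subset; ⁅_⁆; _∪_; _─_; _⊆_; ∁; ⋃; ∣_∣; inside; outside)
  renaming (_∈_ to _∈ₛ_; _∉_ to _∉ₛ_)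
import Data.Fin.Subset as Subset
open import Data.Fin.Subset.Properties
  using (x∈⁅x⁆; x∈⁅y⁆⇒x≡y; x∈p∪q⁺; x∈p∪q⁻; ∉⊥; ∣⊥∣≡0; ∪-identityˡ; p─q⊆p; ∣p∣≤n)
open import Data.List using (List; []; _∷_; length; filterᵇ; map; tabulate)
import Data.List as List
open import Data.List.Membership.Propositional using (_∈_; _∉_; find; lose)
open import Data.List.Membership.Propositional.Properties using (∈-map⁺; ∈-filter⁺; ∈-tabulate⁺)
import Data.List.Membership.DecPropositional as DecMembership
open import Data.List.Properties using (length-map)
open import Data.List.Relation.Unary.All using (All)
open import Data.List.Relation.Unary.AllPairs using (AllPairs)
open import Data.List.Relation.Unary.Any using (Any; here; there; index)
import Data.List.Relation.Unary.Any as Any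
open import Data.List.Relation.Unary.Any.Properties using (lookup-index)
open import Data.Maybe using (Maybe; just; nothing; is-just; maybe′)
open import Data.Nat using (ℕ; zero; suc; _+_; _∸_; _≤_; _<_; _≥_; z≤n; s≤s)
open import Data.Nat.DivMod using (_mod_)
open import Data.Nat.Properties
  using (≤-refl; ≤-reflexive; ≤-trans; <-≤-trans; ≤-<-trans; ≤-pred; <⇒≱; m≤n⇒m≤1+n; n≤1+n; m≤m+n; m<m+n;
         +-suc; +-comm; +-assoc; +-mono-≤; +-monoˡ-≤; +-monoʳ-≤; +-cancelʳ-≤; module ≤-Reasoning)
open import Data.Product using (Σ; ∃; _×_; _,_; proj₁; proj₂; uncurry)
open import Data.Product.Properties using (≡-dec; ,-injective)
open import Data.Sum using (_⊎_; inj₁; inj₂)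
open import Data.Vec using (lookup; _∷_)
import Data.Vec as Vec
open import Data.Vec.Properties using (lookup-map; []=⇒lookup; lookup⇒[]=)
open import Function using (_∘′_)
open import Function.Definitions using (Injective)
open import Relation.Binary.Definitions using (DecidableEquality; tri<; tri≈; tri>)
open import Relation.Binary.PropositionalEquality using (_≡_; _≢_; refl; sym; trans; cong; subst)
open import Relation.Nullary using (Dec; yes; no; ¬_; contradiction)
open import Relation.Nullary.Decidable using (⌊_⌋; toWitness; _→-dec_; _⊎-dec_)

module _ {A : Set} where

  count : (A → Bool) → List A → ℕ
  count p xs = length (filterᵇ p xs)

  count-∷-≤ : ∀ p x xs → count p (x ∷ xs) ≤ suc (count p xs)
  count-∷-≤ p x xs with p x
  ... | true  = ≤-refl
  ... | false = m≤n⇒m≤1+n ≤-refl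

  count-∷-reject : ∀ {p x} xs → p x ≡ false → count p (x ∷ xs) ≡ count p xs
  count-∷-reject {p} {x} xs px rewrite px = refl

  count-none : ∀ p xs → (∀ {x} → x ∈ xs → p x ≡ false) → count p xs ≡ 0
  count-none p []       none = refl
  count-none p (x ∷ xs) none rewrite none (here refl) = count-none p xs (none ∘′ there)

  count-mono : ∀ {p q} → (∀ x → p x ≡ true → q x ≡ true) → ∀ xs → count p xs ≤ count q xs
  count-mono p⇒q [] = z≤n
  count-mono {p} {q} p⇒q (x ∷ xs) with p x | q x | p⇒q x
  ... | true  | true  | _   = s≤s (count-mono p⇒q xs)
  ... | true  | false | imp with () ← imp refl
  ... | false | true  | _   = m≤n⇒m≤1+n (count-mono p⇒q xs)
  ... | false | false | _   = count-mono p⇒q xs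

  count-mono-< : ∀ {p q} → (∀ x → p x ≡ true → q x ≡ true) →
                 ∀ {x} xs → x ∈ xs → q x ≡ true → p x ≡ false → count p xs < count q xs
  count-mono-< {p} {q} p⇒q (x ∷ xs) (here refl) qx px rewrite qx | px = s≤s (count-mono p⇒q xs)
  count-mono-< {p} {q} p⇒q (y ∷ xs) (there x∈xs) qx px with p y | q y | p⇒q y
  ... | true  | true  | _   = s≤s (count-mono-< p⇒q xs x∈xs qx px)
  ... | true  | false | imp with () ← imp refl
  ... | false | true  | _   = m≤n⇒m≤1+n (count-mono-< p⇒q xs x∈xs qx px)
  ... | false | false | _   = count-mono-< p⇒q xs x∈xs qx px

  count-disjoint-+ : ∀ {p q r} → (∀ x → p x ≡ true → r x ≡ true) → (∀ x → q x ≡ true → r x ≡ true) →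
                     (∀ x → p x ≡ true → q x ≡ false) → ∀ xs → count p xs + count q xs ≤ count r xs
  count-disjoint-+ p⇒r q⇒r p⇒¬q [] = z≤n
  count-disjoint-+ {p} {q} {r} p⇒r q⇒r p⇒¬q (x ∷ xs)
    with p x | q x | r x | p⇒r x | q⇒r x | p⇒¬q x | count-disjoint-+ p⇒r q⇒r p⇒¬q xs
  ... | true  | true  | _     | _   | _   | excl | _  with () ← excl refl
  ... | true  | false | true  | _   | _   | _    | ih = s≤s ih
  ... | true  | false | false | imp | _   | _    | _  with () ← imp refl
  ... | false | true  | true  | _   | _   | _    | ih = subst (_≤ suc (count r xs)) (sym (+-suc _ _)) (s≤s ih)
  ... | false | true  | false | _   | imp | _    | _  with () ← imp refl
  ... | false | false | true  | _   | _   | _    | ih = m≤n⇒m≤1+n ih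
  ... | false | false | false | _   | _   | _    | ih = ih

  module _ (_≟_ : DecidableEquality A) where

    injective⇒≤count : ∀ {m} p xs (f : Fin m → A) → Injective _≡_ _≡_ f →
                        (∀ k → f k ∈ xs) → (∀ k → p (f k) ≡ true) → m ≤ count p xs
    injective⇒≤count {zero}  p xs f inj f∈xs pf = z≤n
    injective⇒≤count {suc m} p xs f inj f∈xs pf =
      <-≤-trans (s≤s (injective⇒≤count p′ xs (f ∘′ suc) (suc-injective ∘′ inj) (λ k → f∈xs (suc k)) p′f))
                (count-mono-< p′⇒p xs (f∈xs zero) (pf zero) p′f₀)
      where
      p′ : A → Bool
      p′ y = p y ∧ not ⌊ y ≟ f zero ⌋
      p′⇒p : ∀ y → p′ y ≡ true → p y ≡ true
      p′⇒p y h with p y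
      ... | true = refl
      p′f₀ : p′ (f zero) ≡ false
      p′f₀ with f zero ≟ f zero
      ... | yes _ = ∧-zeroʳ (p (f zero))
      ... | no ¬refl = contradiction refl ¬refl
      p′f : ∀ k → p′ (f (suc k)) ≡ true
      p′f k with f (suc k) ≟ f zero
      ... | yes eq with () ← inj eq
      ... | no _ rewrite pf (suc k) = refl

    distinct⇒2≤count : ∀ p xs {x y} → x ≢ y → x ∈ xs → y ∈ xs → p x ≡ true → p y ≡ true → 2 ≤ count p xs
    distinct⇒2≤count p xs {x} {y} x≢y x∈xs y∈xs px py =
      injective⇒≤count p xs pair pair-injective pair-∈ pair-p
      where
      pair : Fin 2 → A
      pair zero    = x
      pair (suc _) = y
      pair-injective : Injective _≡_ _≡_ pair
      pair-injective {zero}     {zero}     _  = refl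
      pair-injective {zero}     {suc zero} eq = ⊥-elim (x≢y eq)
      pair-injective {suc zero} {zero}     eq = ⊥-elim (x≢y (sym eq))
      pair-injective {suc zero} {suc zero} _  = refl
      pair-∈ : ∀ k → pair k ∈ xs
      pair-∈ zero    = x∈xs
      pair-∈ (suc _) = y∈xs
      pair-p : ∀ k → p (pair k) ≡ true
      pair-p zero    = px
      pair-p (suc _) = py

fresh : ∀ {m} (xs : List (Fin m)) → length xs < m → ∃ λ s → s ∉ xs
fresh {m} xs len = Fin.¬∀⟶∃¬ m (_∈ xs) (λ s → DecMembership._∈?_ _≟_ s xs) ¬covered
  where
  ¬covered : ¬ (∀ s → s ∈ xs)
  ¬covered covered with i , j , i<j , eq ← pigeonhole len (λ s → index (covered s)) =
    <-irrefl (trans (lookup-index (covered i)) (trans (cong (List.lookup xs) eq) (sym (lookup-index (covered j))))) i<j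

-- Only the two decided properties of the shifts are used.
opaque
  shift : Fin 4 → Fin 4 → Fin 4
  shift s i = (toℕ i + toℕ s) mod 4

  unshift : Fin 4 → Fin 4 → Fin 4
  unshift i c = (toℕ c + (4 ∸ toℕ i)) mod 4

  shift-injective : ∀ s i j → shift s i ≡ shift s j → i ≡ j
  shift-injective = toWitness {a? = Fin.all? λ s → Fin.all? λ i → Fin.all? λ j →
                                     (shift s i ≟ shift s j) →-dec (i ≟ j)} _

  shift-unshift : ∀ s i c → shift s i ≡ c → s ≡ unshift i c
  shift-unshift = toWitness {a? = Fin.all? λ s → Fin.all? λ i → Fin.all? λ c →
                                   (shift s i ≟ c) →-dec (s ≟ unshift i c)} _

-- Each constraint (i , c) excludes exactly one shift, namely unshift i c.
opaque
  avoiding-shift : (L : List (Fin 4 × Fin 4)) → length L < 4 →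
                   ∃ λ s → ∀ {i c} → (i , c) ∈ L → shift s i ≢ c
  avoiding-shift L len with s , s∉ ← fresh (map (uncurry unshift) L) (subst (_< 4) (sym (length-map _ L)) len) =
    s , λ {i} {c} ic∈L eq →
      s∉ (subst (_∈ map (uncurry unshift) L) (sym (shift-unshift s i c eq)) (∈-map⁺ (uncurry unshift) ic∈L))

x∉p⇒∣⁅x⁆∪p∣≡1+∣p∣ : ∀ {n} (x : Fin n) (p : Subset n) → x ∉ₛ p → ∣ ⁅ x ⁆ ∪ p ∣ ≡ suc ∣ p ∣
x∉p⇒∣⁅x⁆∪p∣≡1+∣p∣ zero    (outside ∷ p) x∉p rewrite ∪-identityˡ p = refl
x∉p⇒∣⁅x⁆∪p∣≡1+∣p∣ zero    (inside  ∷ p) x∉p = ⊥-elim (x∉p Vec.here)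
x∉p⇒∣⁅x⁆∪p∣≡1+∣p∣ (suc x) (outside ∷ p) x∉p = x∉p⇒∣⁅x⁆∪p∣≡1+∣p∣ x p (x∉p ∘′ Vec.there)
x∉p⇒∣⁅x⁆∪p∣≡1+∣p∣ (suc x) (inside  ∷ p) x∉p = cong suc (x∉p⇒∣⁅x⁆∪p∣≡1+∣p∣ x p (x∉p ∘′ Vec.there))

x∈q⇒x∉p─q : ∀ {n} {x : Fin n} (p q : Subset n) → x ∈ₛ q → x ∉ₛ p ─ q
x∈q⇒x∉p─q (_ ∷ p) (inside ∷ q) Vec.here ()
x∈q⇒x∉p─q (_ ∷ p) (_ ∷ q) (Vec.there x∈q) (Vec.there x∈p─q) = x∈q⇒x∉p─q p q x∈q x∈p─q

image : ∀ {m n} → (Fin m → Fin n) → Subset n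
image {zero}  f = Subset.⊥
image {suc m} f = ⁅ f zero ⁆ ∪ image (f ∘′ suc)

∈-image : ∀ {m n} (f : Fin m → Fin n) i → f i ∈ₛ image f
∈-image f zero    = x∈p∪q⁺ (inj₁ (x∈⁅x⁆ (f zero)))
∈-image f (suc i) = x∈p∪q⁺ (inj₂ (∈-image (f ∘′ suc) i))

image-∈ : ∀ {m n} (f : Fin m → Fin n) {x} → x ∈ₛ image f → ∃ λ i → f i ≡ x
image-∈ {zero}  f x∈ = ⊥-elim (∉⊥ x∈)
image-∈ {suc m} f x∈ with x∈p∪q⁻ ⁅ f zero ⁆ _ x∈
... | inj₁ x∈⁅f₀⁆ = zero , sym (x∈⁅y⁆⇒x≡y _ x∈⁅f₀⁆)
... | inj₂ x∈rest with i , fi≡x ← image-∈ (f ∘′ suc) x∈rest = suc i , fi≡x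

∣image∣≡m : ∀ {m n} (f : Fin m → Fin n) → Injective _≡_ _≡_ f → ∣ image f ∣ ≡ m
∣image∣≡m {zero}  {n} f inj = ∣⊥∣≡0 n
∣image∣≡m {suc m} f inj =
  trans (x∉p⇒∣⁅x⁆∪p∣≡1+∣p∣ (f zero) _ f₀∉) (cong suc (∣image∣≡m (f ∘′ suc) (suc-injective ∘′ inj)))
  where
  f₀∉ : f zero ∉ₛ image (f ∘′ suc)
  f₀∉ f₀∈ with i , eq ← image-∈ (f ∘′ suc) f₀∈ with () ← inj eq

module Graphs {n : ℕ} where

  _≟ₑ_ : DecidableEquality (Edge n)
  _≟ₑ_ = ≡-dec _≟_ _≟_

  Adj? : (H : Graph n) → ∀ x y → Dec (Adj H x y)
  Adj? H x y = DecMembership._∈?_ _≟ₑ_ (x , y) H ⊎-dec DecMembership._∈?_ _≟ₑ_ (y , x) H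

  adj-∷ : ∀ {H : Graph n} {x y} e → Adj H x y → Adj (e ∷ H) x y
  adj-∷ e (inj₁ xy∈H) = inj₁ (there xy∈H)
  adj-∷ e (inj₂ yx∈H) = inj₂ (there yx∈H)

  adj-sym : ∀ {H : Graph n} {x y} → Adj H x y → Adj H y x
  adj-sym (inj₁ xy∈H) = inj₂ xy∈H
  adj-sym (inj₂ yx∈H) = inj₁ yx∈H

  edge : Fin n → Fin n → Edge n
  edge u v with <-cmp u v
  ... | tri> _ _ _ = v , u
  ... | _          = u , v

  edge≡ : ∀ u v → edge u v ≡ (u , v) ⊎ edge u v ≡ (v , u)
  edge≡ u v with <-cmp u v
  ... | tri< _ _ _ = inj₁ refl
  ... | tri≈ _ _ _ = inj₁ refl
  ... | tri> _ _ _ = inj₂ refl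

  edge-< : ∀ {u v} → u ≢ v → proj₁ (edge u v) <ᶠ proj₂ (edge u v)
  edge-< {u} {v} u≢v with <-cmp u v
  ... | tri< u<v _ _ = u<v
  ... | tri≈ _ u≡v _ = ⊥-elim (u≢v u≡v)
  ... | tri> _ _ v<u = v<u

  adj-edge : ∀ {H} u v → Adj (edge u v ∷ H) u v
  adj-edge u v with edge≡ u v
  ... | inj₁ eq = inj₁ (here (sym eq))
  ... | inj₂ eq = inj₂ (here (sym eq))

  Proper : ∀ {k} → Graph n → (Fin n → Fin k) → Set
  Proper H col = ∀ {u v} → (u , v) ∈ H → col u ≢ col v

  proper-∷ : ∀ {k H} {col : Fin n → Fin k} {u v} → Proper H col → col u ≢ col v → Proper (edge u v ∷ H) col
  proper-∷ pr cu≢cv (there m) = pr m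
  proper-∷ {u = u} {v} pr cu≢cv (here eq) with edge≡ u v
  ... | inj₁ e with refl , refl ← ,-injective (trans eq e) = cu≢cv
  ... | inj₂ e with refl , refl ← ,-injective (trans eq e) = cu≢cv ∘′ sym

  legal-edge : ∀ {k H} (col : Fin n → Fin k) → Proper H col →
               ∀ {u v} → u ≢ v → col u ≢ col v → ¬ Adj H u v → Legal k H (edge u v)
  legal-edge col pr {u} {v} u≢v cu≢cv ¬adj =
    edge-< u≢v , (λ m → ¬adj (adj-of m)) , col , proper-∷ pr cu≢cv
    where
    adj-of : ∀ {H} → edge u v ∈ H → Adj H u v
    adj-of m with edge≡ u v
    ... | inj₁ eq = inj₁ (subst (_∈ _) eq m)
    ... | inj₂ eq = inj₂ (subst (_∈ _) eq m)

  incident : Fin n → Edge n → Bool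
  incident x (u , v) = ⌊ u ≟ x ⌋ ∨ ⌊ v ≟ x ⌋

  incident-endpoint : ∀ {x u v} → incident x (u , v) ≡ true → u ≡ x ⊎ v ≡ x
  incident-endpoint {x} {u} {v} h with u ≟ x | v ≟ x
  ... | yes u≡x | _       = inj₁ u≡x
  ... | no _    | yes v≡x = inj₂ v≡x

  incident-left : ∀ u v → incident u (u , v) ≡ true
  incident-left u v with u ≟ u
  ... | yes _ = refl
  ... | no u≢u = ⊥-elim (u≢u refl)

  incident-right : ∀ u v → incident v (u , v) ≡ true
  incident-right u v with u ≟ v | v ≟ v
  ... | yes _ | _     = refl
  ... | no _  | yes _ = refl
  ... | no _  | no v≢v = ⊥-elim (v≢v refl)

  deg≡1⇒unique-incident : ∀ {G x e₀} → deg G x ≡ 1 → e₀ ∈ G → incident x e₀ ≡ true →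
                          ∀ {e} → e ∈ G → incident x e ≡ true → e ≡ e₀
  deg≡1⇒unique-incident {G} {x} {e₀} deg≡1 e₀∈G x∈e₀ {e} e∈G x∈e with e ≟ₑ e₀
  ... | yes e≡e₀ = e≡e₀
  ... | no e≢e₀ with s≤s () ← subst (2 ≤_) deg≡1
        (distinct⇒2≤count _≟ₑ_ (incident x) G (e≢e₀ ∘′ sym) e₀∈G e∈G x∈e₀ x∈e)

  isolated-left : ∀ {G u v} → Isolated G (u , v) → ∀ {e} → e ∈ G → incident u e ≡ true → e ≡ (u , v)
  isolated-left {u = u} {v} (uv∈G , deg-u , _) = deg≡1⇒unique-incident deg-u uv∈G (incident-left u v)

  isolated-right : ∀ {G u v} → Isolated G (u , v) → ∀ {e} → e ∈ G → incident v e ≡ true → e ≡ (u , v)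
  isolated-right {u = u} {v} (uv∈G , _ , deg-v) = deg≡1⇒unique-incident deg-v uv∈G (incident-right u v)

  touches : Subset n → Edge n → Bool
  touches W (u , v) = lookup W u ∨ lookup W v

  phi≡count-touches : ∀ W H → phi W H ≡ count (touches W) H
  phi≡count-touches W [] = refl
  phi≡count-touches W ((u , v) ∷ H) rewrite lookup-map u not W | lookup-map v not W
    with lookup W u | lookup W v
  ... | true  | true  = cong suc (phi≡count-touches W H)
  ... | true  | false = trans (+-suc _ _) (cong suc (phi≡count-touches W H))
  ... | false | true  = trans (+-suc _ _) (cong suc (phi≡count-touches W H))
  ... | false | false = phi≡count-touches W H

module Corners {n : ℕ} (corner : Fin 4 → Fin n) (corner-injective : Injective _≡_ _≡_ corner) where

  open Graphs {n}

  position : Fin n → Maybe (Fin 4)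
  position x with Fin.any? (λ i → corner i ≟ x)
  ... | yes (i , _) = just i
  ... | no _        = nothing

  position-corner : ∀ i → position (corner i) ≡ just i
  position-corner i with Fin.any? (λ j → corner j ≟ corner i)
  ... | yes (j , cj≡ci) = cong just (corner-injective cj≡ci)
  ... | no none         = ⊥-elim (none (i , refl))

  position-just : ∀ {x i} → position x ≡ just i → corner i ≡ x
  position-just {x} eq with Fin.any? (λ j → corner j ≟ x)
  position-just refl | yes (j , cj≡x) = cj≡x

  position-nothing : ∀ {x} → position x ≡ nothing → ∀ i → corner i ≢ x
  position-nothing px i refl with () ← trans (sym px) (position-corner i)

  position-cases : ∀ x → (∃ λ k → corner k ≡ x) ⊎ position x ≡ nothing
  position-cases x with position x in px
  ... | just k  = inj₁ (k , position-just px)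
  ... | nothing = inj₂ refl

  position-outside : ∀ {x} → x ∉ tabulate corner → position x ≡ nothing
  position-outside {x} x∉ with position-cases x
  ... | inj₁ (k , refl) = ⊥-elim (x∉ (∈-tabulate⁺ {f = corner} k))
  ... | inj₂ px         = px

  crossing : Edge n → Bool
  crossing (u , v) = is-just (position u) xor is-just (position v)

  crossing-corners : ∀ i j → crossing (corner i , corner j) ≡ false
  crossing-corners i j rewrite position-corner i | position-corner j = refl

  crossing-outside : ∀ {u v} → position u ≡ nothing → position v ≡ nothing → crossing (u , v) ≡ false
  crossing-outside pu pv rewrite pu | pv = refl

  Rainbow : (Fin n → Fin 4) → Set
  Rainbow col = Injective _≡_ _≡_ (col ∘′ corner)

  -- On a crossing edge: the corner's index and the colour of its outside neighbour,
  -- which the corner must avoid.  The value on other edges is irrelevant.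
  constraint : (Fin n → Fin 4) → Edge n → Fin 4 × Fin 4
  constraint col (u , v) =
    maybe′ (λ i → i , col v) (maybe′ (λ j → j , col u) (zero , zero) (position v)) (position u)

  recolour : ∀ {H} (col : Fin n → Fin 4) → Proper H col → count crossing H < 4 →
             ∃ λ col′ → Proper H col′ × Rainbow col′
  recolour {H} col pr few = col′ , proper′ , rainbow′
    where
    constraints : List (Fin 4 × Fin 4)
    constraints = map (constraint col) (filterᵇ crossing H)

    avoiding : ∃ λ s → ∀ {i c} → (i , c) ∈ constraints → shift s i ≢ c
    avoiding = avoiding-shift constraints (subst (_< 4) (sym (length-map (constraint col) (filterᵇ crossing H))) few)

    s : Fin 4
    s = proj₁ avoiding

    avoids : ∀ {i c} → (i , c) ∈ constraints → shift s i ≢ c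
    avoids = proj₂ avoiding

    listed : ∀ {u v} → (u , v) ∈ H → crossing (u , v) ≡ true → constraint col (u , v) ∈ constraints
    listed m c = ∈-map⁺ (constraint col) (∈-filter⁺ (λ e → T? (crossing e)) m (subst T (sym c) _))

    col′ : Fin n → Fin 4
    col′ x = maybe′ (shift s) (col x) (position x)

    rainbow′ : Rainbow col′
    rainbow′ {i} {j} eq rewrite position-corner i | position-corner j = shift-injective s i j eq

    proper′ : Proper H col′
    proper′ {u} {v} m with position u in pu | position v in pv
    ... | nothing | nothing = pr m
    ... | just i  | just j  = λ eq →
      pr m (cong col (trans (sym (position-just pu)) (trans (cong corner (shift-injective s i j eq)) (position-just pv))))
    ... | just i  | nothing = avoids (subst (_∈ constraints) (eq pu) (listed m (c pu pv)))
      where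
      eq : position u ≡ just i → constraint col (u , v) ≡ (i , col v)
      eq pu rewrite pu = refl
      c : position u ≡ just i → position v ≡ nothing → crossing (u , v) ≡ true
      c pu pv rewrite pu | pv = refl
    ... | nothing | just j  = avoids (subst (_∈ constraints) (eq pu pv) (listed m (c pu pv))) ∘′ sym
      where
      eq : position u ≡ nothing → position v ≡ just j → constraint col (u , v) ≡ (j , col u)
      eq pu pv rewrite pu | pv = refl
      c : position u ≡ nothing → position v ≡ just j → crossing (u , v) ≡ true
      c pu pv rewrite pu | pv = refl

  crossingAt : Fin n → Edge n → Bool
  crossingAt x e = crossing e ∧ incident x e

  crossingAt-disjoint : ∀ {x y} → position x ≡ nothing → position y ≡ nothing → x ≢ y →
                        ∀ e → crossingAt x e ≡ true → crossingAt y e ≡ false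
  crossingAt-disjoint {x} {y} px py x≢y (u , v) at-x with crossingAt y (u , v) in at-y
  ... | false = refl
  ... | true with incident-endpoint {x} {u} {v} (∧-conicalʳ _ _ at-x) | incident-endpoint {y} {u} {v} (∧-conicalʳ _ _ at-y)
  ...   | inj₁ refl | inj₁ refl = ⊥-elim (x≢y refl)
  ...   | inj₂ refl | inj₂ refl = ⊥-elim (x≢y refl)
  ...   | inj₁ refl | inj₂ refl with () ← trans (sym (∧-conicalˡ _ _ at-x)) (crossing-outside px py)
  ...   | inj₂ refl | inj₁ refl with () ← trans (sym (∧-conicalˡ _ _ at-x)) (crossing-outside py px)

  link : ∀ {H : Graph n} {x y} → Adj H x y → Edge n
  link {x = x} {y} (inj₁ _) = x , y
  link {x = x} {y} (inj₂ _) = y , x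

  link-∈ : ∀ {H : Graph n} {x y} (a : Adj H x y) → link a ∈ H
  link-∈ (inj₁ m) = m
  link-∈ (inj₂ m) = m

  link-crossingAt : ∀ {H : Graph n} {x j} → position x ≡ nothing → (a : Adj H x (corner j)) →
                    crossingAt x (link a) ≡ true
  link-crossingAt {x = x} {j} px (inj₁ _) rewrite px | position-corner j = incident-left x (corner j)
  link-crossingAt {x = x} {j} px (inj₂ _) rewrite px | position-corner j = incident-right (corner j) x

  link-injective : ∀ {H : Graph n} {x j k} → position x ≡ nothing →
                   (a : Adj H x (corner j)) (b : Adj H x (corner k)) → link a ≡ link b → j ≡ k
  link-injective px (inj₁ _) (inj₁ _) eq = corner-injective (proj₂ (,-injective eq))
  link-injective px (inj₁ _) (inj₂ _) eq = ⊥-elim (position-nothing px _ (sym (proj₁ (,-injective eq))))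
  link-injective px (inj₂ _) (inj₁ _) eq = ⊥-elim (position-nothing px _ (proj₁ (,-injective eq)))
  link-injective px (inj₂ _) (inj₂ _) eq = corner-injective (proj₁ (,-injective eq))

  clash-free : ∀ (col : Fin n → Fin 4) → Rainbow col → ∀ x →
               ∃ λ j₀ → ∀ k → col (corner (punchIn j₀ k)) ≢ col x
  clash-free col rainbow x with Fin.any? (λ j → col (corner j) ≟ col x)
  ... | yes (j₀ , clash) = j₀ , λ k eq → punchInᵢ≢i j₀ k (rainbow (trans eq (sym clash)))
  ... | no none          = zero , λ k eq → none (_ , eq)

  legal-or-3≤crossingAt : ∀ {H} (col : Fin n → Fin 4) → Proper H col → Rainbow col →
                          ∀ {x} → position x ≡ nothing → (∃ λ e → Legal 4 H e) ⊎ 3 ≤ count (crossingAt x) H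
  legal-or-3≤crossingAt {H} col pr rainbow {x} px with clash-free col rainbow x
  ... | j₀ , free with Fin.all? (λ k → Adj? H x (corner (punchIn j₀ k)))
  ...   | yes adj = inj₂ (injective⇒≤count _≟ₑ_ (crossingAt x) H (λ k → link (adj k))
                            (λ eq → punchIn-injective j₀ _ _ (link-injective px (adj _) (adj _) eq))
                            (λ k → link-∈ (adj k)) (λ k → link-crossingAt px (adj k)))
  ...   | no ¬all with k , ¬adj ← Fin.¬∀⟶∃¬ 3 _ (λ k → Adj? H x (corner (punchIn j₀ k))) ¬all =
    inj₁ (_ , legal-edge col pr (position-nothing px _ ∘′ sym) (free k ∘′ sym) ¬adj)

  -- Otherwise each of two non-corners x, y is adjacent to the three corners whose colour
  -- differs from its own, which takes six crossing edges.
  unsaturated : 6 ≤ n → ∀ {H} (col : Fin n → Fin 4) → Proper H col → Rainbow col →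
                count crossing H < 4 → ¬ Saturated 4 H
  unsaturated 6≤n {H} col pr rainbow few saturated
    with x , x∉ ← fresh (tabulate corner) (≤-trans (n≤1+n 5) 6≤n)
    with y , y∉ ← fresh (x ∷ tabulate corner) 6≤n
    with legal-or-3≤crossingAt col pr rainbow (position-outside x∉)
       | legal-or-3≤crossingAt col pr rainbow (position-outside (y∉ ∘′ there))
  ... | inj₁ legal | _          = saturated legal
  ... | inj₂ _     | inj₁ legal = saturated legal
  ... | inj₂ 3≤x   | inj₂ 3≤y   =
    <⇒≱ few (≤-trans (m≤m+n 4 2) (≤-trans (+-mono-≤ 3≤x 3≤y)
      (count-disjoint-+ (λ e → ∧-conicalˡ _ _) (λ e → ∧-conicalˡ _ _)
        (crossingAt-disjoint (position-outside x∉) (position-outside (y∉ ∘′ there)) (λ x≡y → y∉ (here (sym x≡y))))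
        H)))

module Strategy {n : ℕ} (corner : Fin 4 → Fin n) (corner-injective : Injective _≡_ _≡_ corner)
  (G : Graph n) (W : Subset n) (corner∈W : ∀ i → corner i ∈ₛ W)
  (01∈G : (corner 0F , corner 1F) ∈ G) (23∈G : (corner 2F , corner 3F) ∈ G)
  (G-noncrossing : ∀ {e} → e ∈ G → Corners.crossing corner corner-injective e ≡ false)
  (6≤n : 6 ≤ n) (G-colourable : Colorable 4 G) where

  open Graphs {n}
  open Corners corner corner-injective

  Goal : Graph n → Set
  Goal H = Σ (Subset n) λ V′ → V′ ⊆ W × ∣ V′ ∣ ≡ 4 × Clique H V′ × phi (W ─ V′) H ≤ phi W G + 2

  -- image corner and W′ are V_{i+1} and W(i+1) of the paper.
  W′ : Subset n
  W′ = W ─ image corner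

  W′-corner : ∀ i → lookup W′ (corner i) ≡ false
  W′-corner i with lookup W′ (corner i) in eq
  ... | false = refl
  ... | true  = ⊥-elim (x∈q⇒x∉p─q W (image corner) (∈-image corner i) (lookup⇒[]= (corner i) W′ eq))

  W′⊆W : ∀ x → lookup W′ x ≡ true → lookup W x ≡ true
  W′⊆W x eq = []=⇒lookup (p─q⊆p W (image corner) (lookup⇒[]= x W′ eq))

  corner-edge : ∀ i j → ∃ λ k → ∃ λ l → edge (corner i) (corner j) ≡ (corner k , corner l)
  corner-edge i j with edge≡ (corner i) (corner j)
  ... | inj₁ eq = i , j , eq
  ... | inj₂ eq = j , i , eq

  crossing-corner-edge : ∀ i j → crossing (edge (corner i) (corner j)) ≡ false
  crossing-corner-edge i j with k , l , eq ← corner-edge i j rewrite eq = crossing-corners k l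

  touches-W′-corner-edge : ∀ i j → touches W′ (edge (corner i) (corner j)) ≡ false
  touches-W′-corner-edge i j with k , l , eq ← corner-edge i j rewrite eq | W′-corner k | W′-corner l = refl

  targets : List (Fin 4 × Fin 4)
  targets = (0F , 2F) ∷ (0F , 3F) ∷ (1F , 2F) ∷ (1F , 3F) ∷ []

  targets-distinct : ∀ {i j} → (i , j) ∈ targets → i ≢ j
  targets-distinct (here refl)                         = λ ()
  targets-distinct (there (here refl))                 = λ ()
  targets-distinct (there (there (here refl)))         = λ ()
  targets-distinct (there (there (there (here refl)))) = λ ()

  missing : Graph n → Fin 4 × Fin 4 → Bool
  missing H (i , j) = not ⌊ Adj? H (corner i) (corner j) ⌋

  missing⇒¬adj : ∀ {H i j} → missing H (i , j) ≡ true → ¬ Adj H (corner i) (corner j)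
  missing⇒¬adj {H} {i} {j} miss adj with Adj? H (corner i) (corner j)
  missing⇒¬adj () adj | yes _
  ... | no ¬adj = ¬adj adj

  ¬adj⇒missing : ∀ {H i j} → ¬ Adj H (corner i) (corner j) → missing H (i , j) ≡ true
  ¬adj⇒missing {H} {i} {j} ¬adj with Adj? H (corner i) (corner j)
  ... | yes adj = ⊥-elim (¬adj adj)
  ... | no _    = refl

  missing-∷ : ∀ {H} e p → missing (e ∷ H) p ≡ true → missing H p ≡ true
  missing-∷ e (i , j) miss = ¬adj⇒missing (missing⇒¬adj miss ∘′ adj-∷ e)

  filled : ∀ {H} f i j → missing (f ∷ edge (corner i) (corner j) ∷ H) (i , j) ≡ false
  filled {H} f i j with Adj? (f ∷ edge (corner i) (corner j) ∷ H) (corner i) (corner j)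
  ... | yes _   = refl
  ... | no ¬adj = ⊥-elim (¬adj (adj-∷ f (adj-edge (corner i) (corner j))))

  -- After r rounds, each consisting of a corner edge by Maxi and an arbitrary edge by Mini.
  record Invariant (H : Graph n) (r : ℕ) : Set where
    field
      G⊆H        : ∀ {e} → e ∈ G → e ∈ H
      colourable : Colorable 4 H
      crossings  : count crossing H ≤ r
      touching   : count (touches W′) H + 2 ≤ r + count (touches W) G

  touches-W′⇒W : ∀ e → touches W′ e ≡ true → touches W e ≡ true
  touches-W′⇒W (u , v) h with lookup W′ u in in-u | lookup W′ v in in-v
  ... | true  | _    rewrite W′⊆W u in-u = refl
  ... | false | true rewrite W′⊆W v in-v = ∨-zeroʳ (lookup W u)

  leaves : Edge n → Bool
  leaves e = touches W e ∧ not (touches W′ e)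

  leaves-corners : ∀ i j → leaves (corner i , corner j) ≡ true
  leaves-corners i j rewrite []=⇒lookup (corner∈W i) | W′-corner i | W′-corner j = refl

  initial : Invariant G 0
  initial = record
    { G⊆H        = λ e∈G → e∈G
    ; colourable = G-colourable
    ; crossings  = ≤-reflexive (count-none crossing G G-noncrossing)
    ; touching   = ≤-trans (+-monoʳ-≤ (count (touches W′) G) two-leave)
                     (count-disjoint-+ touches-W′⇒W (λ e → ∧-conicalˡ _ _)
                        (λ e h → trans (cong (λ b → touches W e ∧ not b) h) (∧-zeroʳ _)) G)
    }
    where
    two-leave : 2 ≤ count leaves G
    two-leave = distinct⇒2≤count _≟ₑ_ leaves G (λ eq → 0≢2 (corner-injective (proj₁ (,-injective eq))))
                  01∈G 23∈G (leaves-corners 0F 1F) (leaves-corners 2F 3F)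
      where 0≢2 : 0F ≢ 2F
            0≢2 ()

  invariant-step : ∀ {H r} f i j → Invariant H r → Colorable 4 (f ∷ edge (corner i) (corner j) ∷ H) →
                   Invariant (f ∷ edge (corner i) (corner j) ∷ H) (suc r)
  invariant-step {H} {r} f i j inv colourable′ = record
    { G⊆H        = there ∘′ there ∘′ G⊆H
    ; colourable = colourable′
    ; crossings  = ≤-trans (count-∷-≤ crossing f _)
                     (s≤s (subst (_≤ r) (sym (count-∷-reject H (crossing-corner-edge i j))) crossings))
    ; touching   = ≤-trans (+-monoˡ-≤ 2 (count-∷-≤ (touches W′) f _))
                     (s≤s (subst (λ m → m + 2 ≤ r + _) (sym (count-∷-reject H (touches-W′-corner-edge i j))) touching))
    }
    where open Invariant inv

  goal : ∀ {H r} → Invariant H r → r ≤ 4 → (∀ {i j} → (i , j) ∈ targets → Adj H (corner i) (corner j)) → Goal H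
  goal {H} {r} inv r≤4 complete =
    image corner , image⊆W , ∣image∣≡m corner corner-injective , clique , phi-bound
    where
    open Invariant inv
    image⊆W : image corner ⊆ W
    image⊆W x∈ with i , refl ← image-∈ corner x∈ = corner∈W i

    adjacent : ∀ i j → i ≢ j → Adj H (corner i) (corner j)
    adjacent 0F 0F i≢j = ⊥-elim (i≢j refl)
    adjacent 0F 1F _   = inj₁ (G⊆H 01∈G)
    adjacent 0F 2F _   = complete (here refl)
    adjacent 0F 3F _   = complete (there (here refl))
    adjacent 1F 0F _   = inj₂ (G⊆H 01∈G)
    adjacent 1F 1F i≢j = ⊥-elim (i≢j refl)
    adjacent 1F 2F _   = complete (there (there (here refl)))
    adjacent 1F 3F _   = complete (there (there (there (here refl))))
    adjacent 2F 0F _   = adj-sym (complete (here refl))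
    adjacent 2F 1F _   = adj-sym (complete (there (there (here refl))))
    adjacent 2F 2F i≢j = ⊥-elim (i≢j refl)
    adjacent 2F 3F _   = inj₁ (G⊆H 23∈G)
    adjacent 3F 0F _   = adj-sym (complete (there (here refl)))
    adjacent 3F 1F _   = adj-sym (complete (there (there (there (here refl)))))
    adjacent 3F 2F _   = inj₂ (G⊆H 23∈G)
    adjacent 3F 3F i≢j = ⊥-elim (i≢j refl)

    clique : Clique H (image corner)
    clique x∈ y∈ x≢y with i , refl ← image-∈ corner x∈ | j , refl ← image-∈ corner y∈ =
      adjacent i j (x≢y ∘′ cong corner)

    phi-bound : phi W′ H ≤ phi W G + 2
    phi-bound rewrite phi≡count-touches W′ H | phi≡count-touches W G =
      +-cancelʳ-≤ 2 _ _ (≤-trans touching (begin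
        r + count (touches W) G   ≤⟨ +-monoˡ-≤ _ r≤4 ⟩
        4 + count (touches W) G   ≡⟨ +-comm 4 _ ⟩
        count (touches W) G + 4   ≡⟨ sym (+-assoc (count (touches W) G) 2 2) ⟩
        count (touches W) G + 2 + 2 ∎))
      where open ≤-Reasoning

  complete : ∀ {H} → ¬ Any (λ p → missing H p ≡ true) targets →
             ∀ {i j} → (i , j) ∈ targets → Adj H (corner i) (corner j)
  complete {H} none {i} {j} ij∈ with Adj? H (corner i) (corner j)
  ... | yes adj = adj
  ... | no ¬adj = ⊥-elim (none (lose ij∈ (¬adj⇒missing ¬adj)))

  mutual
    strategy : ∀ d {H r} → Invariant H r → r + d ≤ 4 → count (missing H) targets ≤ d → MaxiForces 4 Goal d H
    strategy d {H} {r} inv budget few with Any.any? (λ p → missing H p Bool.≟ true) targets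
    ... | no none = done (goal inv (≤-trans (m≤m+n r d) budget) (complete none))
    ... | yes some with (i , j) , ij∈ , miss ← find some = maxi-move d inv budget few ij∈ miss

    maxi-move : ∀ d {H r i j} → Invariant H r → r + d ≤ 4 → count (missing H) targets ≤ d →
                (i , j) ∈ targets → missing H (i , j) ≡ true → MaxiForces 4 Goal d H
    maxi-move zero {H} inv budget few ij∈ miss =
      ⊥-elim (<⇒≱ (count-mono-< {q = missing H} (λ _ ()) targets ij∈ miss refl) few)
    maxi-move (suc d) {H} {r} {i} {j} inv budget few ij∈ miss = move e legal unsat reply
      where
      open Invariant inv
      e : Edge n
      e = edge (corner i) (corner j)
      crossings<4 : count crossing H < 4
      crossings<4 = ≤-<-trans crossings (<-≤-trans (m<m+n r (s≤s z≤n)) budget)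
      recoloured : ∃ λ col′ → Proper H col′ × Rainbow col′
      recoloured = recolour (proj₁ colourable) (proj₂ colourable) crossings<4
      col′ : Fin n → Fin 4
      col′ = proj₁ recoloured
      proper′ : Proper H col′
      proper′ = proj₁ (proj₂ recoloured)
      rainbow′ : Rainbow col′
      rainbow′ = proj₂ (proj₂ recoloured)
      i≢j : i ≢ j
      i≢j = targets-distinct ij∈
      colours-differ : col′ (corner i) ≢ col′ (corner j)
      colours-differ = i≢j ∘′ rainbow′
      legal : Legal 4 H e
      legal = legal-edge col′ proper′ (i≢j ∘′ corner-injective) colours-differ (missing⇒¬adj miss)
      unsat : ¬ Saturated 4 (e ∷ H)
      unsat = unsaturated 6≤n col′ (proper-∷ proper′ colours-differ) rainbow′
                (subst (_< 4) (sym (count-∷-reject H (crossing-corner-edge i j))) crossings<4)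
      reply : ∀ f → Legal 4 (e ∷ H) f → MaxiForces 4 Goal d (f ∷ e ∷ H)
      reply f (_ , _ , colourable′) =
        strategy d (invariant-step f i j inv colourable′) (subst (_≤ 4) (+-suc r d) budget)
          (≤-pred (<-≤-trans (count-mono-< (λ p → missing-∷ e p ∘′ missing-∷ f p) targets ij∈ miss (filled f i j))
                             few))

  maxi-forces-goal : MaxiForces 4 Goal 4 G
  maxi-forces-goal = strategy 4 initial ≤-refl (count-mono {p = missing G} (λ _ _ → refl) targets)

module TwoIsolatedEdges {n} {G : Graph n} (normalised : Normalised G) {a b c d : Fin n}
  (iso-ab : Isolated G (a , b)) (iso-cd : Isolated G (c , d)) (ab≢cd : (a , b) ≢ (c , d)) where

  open Graphs {n}

  ab∈G : (a , b) ∈ G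
  ab∈G = proj₁ iso-ab

  cd∈G : (c , d) ∈ G
  cd∈G = proj₁ iso-cd

  corner : Fin 4 → Fin n
  corner 0F = a
  corner 1F = b
  corner 2F = c
  corner 3F = d

  shared-endpoint : ∀ {x} → x ≡ a ⊎ x ≡ b → x ≡ c ⊎ x ≡ d → ⊥
  shared-endpoint x∈ab x∈cd = ab≢cd (sym (only-ab x∈ab cd∈G (incident-cd x∈cd)))
    where
    only-ab : ∀ {x} → x ≡ a ⊎ x ≡ b → ∀ {e} → e ∈ G → incident x e ≡ true → e ≡ (a , b)
    only-ab (inj₁ refl) = isolated-left iso-ab
    only-ab (inj₂ refl) = isolated-right iso-ab
    incident-cd : ∀ {x} → x ≡ c ⊎ x ≡ d → incident x (c , d) ≡ true
    incident-cd (inj₁ refl) = incident-left c d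
    incident-cd (inj₂ refl) = incident-right c d

  corner-injective : Injective _≡_ _≡_ corner
  corner-injective {0F} {0F} _  = refl
  corner-injective {0F} {1F} eq = ⊥-elim (<⇒≢ (normalised ab∈G) eq)
  corner-injective {0F} {2F} eq = ⊥-elim (shared-endpoint (inj₁ refl) (inj₁ eq))
  corner-injective {0F} {3F} eq = ⊥-elim (shared-endpoint (inj₁ refl) (inj₂ eq))
  corner-injective {1F} {0F} eq = ⊥-elim (<⇒≢ (normalised ab∈G) (sym eq))
  corner-injective {1F} {1F} _  = refl
  corner-injective {1F} {2F} eq = ⊥-elim (shared-endpoint (inj₂ refl) (inj₁ eq))
  corner-injective {1F} {3F} eq = ⊥-elim (shared-endpoint (inj₂ refl) (inj₂ eq))
  corner-injective {2F} {0F} eq = ⊥-elim (shared-endpoint (inj₁ eq) (inj₁ refl))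
  corner-injective {2F} {1F} eq = ⊥-elim (shared-endpoint (inj₂ eq) (inj₁ refl))
  corner-injective {2F} {2F} _  = refl
  corner-injective {2F} {3F} eq = ⊥-elim (<⇒≢ (normalised cd∈G) eq)
  corner-injective {3F} {0F} eq = ⊥-elim (shared-endpoint (inj₁ eq) (inj₂ refl))
  corner-injective {3F} {1F} eq = ⊥-elim (shared-endpoint (inj₂ eq) (inj₂ refl))
  corner-injective {3F} {2F} eq = ⊥-elim (<⇒≢ (normalised cd∈G) (sym eq))
  corner-injective {3F} {3F} _  = refl

  open Corners corner corner-injective

  corner-edges : ∀ k {e} → e ∈ G → incident (corner k) e ≡ true → e ≡ (a , b) ⊎ e ≡ (c , d)
  corner-edges 0F e∈G at = inj₁ (isolated-left iso-ab e∈G at)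
  corner-edges 1F e∈G at = inj₁ (isolated-right iso-ab e∈G at)
  corner-edges 2F e∈G at = inj₂ (isolated-left iso-cd e∈G at)
  corner-edges 3F e∈G at = inj₂ (isolated-right iso-cd e∈G at)

  noncrossing-at : ∀ k {e} → e ∈ G → incident (corner k) e ≡ true → crossing e ≡ false
  noncrossing-at k e∈G at with corner-edges k e∈G at
  ... | inj₁ refl = crossing-corners 0F 1F
  ... | inj₂ refl = crossing-corners 2F 3F

  G-noncrossing : ∀ {e} → e ∈ G → crossing e ≡ false
  G-noncrossing {u , v} e∈G with position-cases u | position-cases v
  ... | inj₁ (k , refl) | _               = noncrossing-at k e∈G (incident-left (corner k) v)
  ... | inj₂ _          | inj₁ (k , refl) = noncrossing-at k e∈G (incident-right u (corner k))
  ... | inj₂ pu         | inj₂ pv         = crossing-outside pu pv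

lemma5p2 : (n : ℕ) (G : Graph n) (Vs : List (Subset n))
    → ValidPosition 4 G
    → AllPairs Disjoint Vs
    → All (Clique G) Vs
    → ∣ ∁ (⋃ Vs) ∣ ≥ 6
    → (∃ λ e → ∃ λ e' → e ≢ e'
         × BothIn (∁ (⋃ Vs)) e × BothIn (∁ (⋃ Vs)) e'
         × Isolated G e × Isolated G e')
    → MaxiForces 4
        (λ H → Σ (Subset n) λ V′ → V′ ⊆ ∁ (⋃ Vs) × ∣ V′ ∣ ≡ 4 × Clique H V′
                 × phi (∁ (⋃ Vs) ─ V′) H ≤ phi (∁ (⋃ Vs)) G + 2)
        4 G
lemma5p2 n G Vs (_ , normalised , colourable) _ _ 6≤∣W∣
         ((a , b) , (c , d) , ab≢cd , (a∈W , b∈W) , (c∈W , d∈W) , iso-ab , iso-cd) =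
  Strategy.maxi-forces-goal corner corner-injective G (∁ (⋃ Vs)) corner∈W ab∈G cd∈G G-noncrossing
    (≤-trans 6≤∣W∣ (∣p∣≤n (∁ (⋃ Vs)))) colourable
  where
  open TwoIsolatedEdges normalised iso-ab iso-cd ab≢cd
  corner∈W : ∀ i → corner i ∈ₛ ∁ (⋃ Vs)
  corner∈W 0F = a∈W
  corner∈W 1F = b∈W
  corner∈W 2F = c∈W
  corner∈W 3F = d∈W
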